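{- If ${\cal G}$ is closed under intersection and complementation, then ${\rm K}^C_{\cal G}$ is a sound and complete axiomatization for the language ${\cal L}^C_{\cal G}$ with respect to ${\cal M}_{\cal A}$.
   Context: ${\cal A}$ is a (possibly infinite) set of agents and ${\cal G}$ a set of nonempty subsets of ${\cal A}$. ${\cal L}^C_{\cal G}$ is the smallest set of formulas containing a fixed set $\Phi$ of primitive propositions and closed under $\wedge,\neg$, $K_i$ ($i\in{\cal A}$), $E_G,C_G$ ($G\in{\cal G}$). Kripke structures $M=(S,\pi,\{{\cal K}_i\}_{i\in{\cal A}})$, $(M,s)\models K_i\phi$ iff $\phi$ holds at all ${\cal K}_i$-successors of $s$; $(M,s)\models E_G\phi$ iff $(M,s)\models K_i\phi$ for all $i\in G$; $(M,s)\models C_G\phi$ iff $(M,s)\models E_G^k\phi$ for all $k\ge1$. ${\cal M}_{\cal A}$ is the class of all Kripke structures over ${\cal A}$. ${\rm K}^C_{\cal G}$ consists of: Prop (all substitution instances of propositional tautologies); K1: $(K_i\phi\wedge K_i(\phi\Rightarrow\psi))\Rightarrow K_i\psi$; MP: from $\phi$ and $\phi\Rightarrow\psi$ infer $\psi$; KGen: from $\phi$ infer $K_i\phi$; E1: $E_G\phi\Rightarrow K_i\phi$ for $i\in G$; E2: $(\bigwedge_{i\in{\cal A}'}K_i\phi\wedge\bigwedge_{G'\in{\cal G}'}E_{G'}\phi)\Rightarrow E_G\phi$ for finite ${\cal A}'\subseteq{\cal A}$, finite ${\cal G}'\subseteq{\cal G}$ with $G\subseteq{\cal A}'\cup\bigcup{\cal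 G}'$; E3: $(E_G\phi\wedge E_G(\phi\Rightarrow\psi))\Rightarrow E_G\psi$; EGen: from $\phi$ infer $E_G\phi$; C1: $C_G\phi\Rightarrow E_G(\phi\wedge C_G\phi)$; RC1: from $\phi\Rightarrow E_G(\psi\wedge\phi)$ infer $\phi\Rightarrow C_G\psi$ (for all $i\in{\cal A}$, $G\in{\cal G}$). -}

module Defs where

open import Level using (Level; _⊔_; Lift; 0ℓ) renaming (suc to lsuc)
open import Data.Nat using (ℕ; zero; suc)
open import Data.Bool using (Bool; true; false; _∧_; not; T)
open import Data.Empty using (⊥)
open import Data.Product using (Σ; _×_; _,_; proj₁)
open import Data.Sum using (_⊎_)
open import Data.List using (List; []; _∷_; map; _++_)
open import Data.List.Membership.Propositional using (_∈_)
open import Data.List.Relation.Unary.Any using (Any)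
open import Relation.Binary.PropositionalEquality using (_≡_)
open import Relation.Unary using (Pred)

data PForm : Set where
  pvar : ℕ → PForm
  pand : PForm → PForm → PForm
  pneg : PForm → PForm

peval : (ℕ → Bool) → PForm → Bool
peval v (pvar n)   = v n
peval v (pand a b) = peval v a ∧ peval v b
peval v (pneg a)   = not (peval v a)

Tautology : PForm → Set
Tautology τ = ∀ (v : ℕ → Bool) → peval v τ ≡ true

-- The logic, for a set A of agents, a set Φ of primitive propositions
-- and a set 𝒢 of subsets of A (subsets of A are predicates Pred A 0ℓ).

module Logic (A Φ : Set) (𝒢 : Pred (Pred A 0ℓ) 0ℓ) where

  data Formula : Set₁ where
    prim : Φ → Formula
    _∧f_ : Formula → Formula → Formula
    ¬f_  : Formula → Formula
    K    : A → Formula → Formula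
    E    : (G : Pred A 0ℓ) → 𝒢 G → Formula → Formula
    C    : (G : Pred A 0ℓ) → 𝒢 G → Formula → Formula

  infixr 6 _∧f_
  infixr 5 _⇒_

  _⇒_ : Formula → Formula → Formula
  φ ⇒ ψ = ¬f (φ ∧f ¬f ψ)

  inst : (ℕ → Formula) → PForm → Formula
  inst σ (pvar n)   = σ n
  inst σ (pand a b) = inst σ a ∧f inst σ b
  inst σ (pneg a)   = ¬f inst σ a

  -- finite conjunction of a list of formulas; the first argument is the
  -- value used for the empty conjunction ("true")
  ⋀ : Formula → List Formula → Formula
  ⋀ t []           = t
  ⋀ t (x ∷ [])     = x
  ⋀ t (x ∷ y ∷ xs) = x ∧f ⋀ t (y ∷ xs)

  Group : Set₁
  Group = Σ (Pred A 0ℓ) 𝒢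

  data Thm : Formula → Set₁ where
    Prop : (τ : PForm) → Tautology τ → (σ : ℕ → Formula) → Thm (inst σ τ)
    K1   : ∀ i φ ψ → Thm ((K i φ ∧f K i (φ ⇒ ψ)) ⇒ K i ψ)
    MP   : ∀ {φ ψ} → Thm φ → Thm (φ ⇒ ψ) → Thm ψ
    KGen : ∀ i {φ} → Thm φ → Thm (K i φ)
    E1   : ∀ G (g : 𝒢 G) φ i → G i → Thm (E G g φ ⇒ K i φ)
    E2   : ∀ G (g : 𝒢 G) φ (A′ : List A) (𝒢′ : List Group) →
           (∀ a → G a → (a ∈ A′) ⊎ Any (λ H → proj₁ H a) 𝒢′) →
           Thm (⋀ (φ ⇒ φ) (map (λ i → K i φ) A′ ++
                           map (λ H → E (proj₁ H) (Data.Product.proj₂ H) φ) 𝒢′)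
                ⇒ E G g φ)
    E3   : ∀ G (g : 𝒢 G) φ ψ → Thm ((E G g φ ∧f E G g (φ ⇒ ψ)) ⇒ E G g ψ)
    EGen : ∀ G (g : 𝒢 G) {φ} → Thm φ → Thm (E G g φ)
    C1   : ∀ G (g : 𝒢 G) φ → Thm (C G g φ ⇒ E G g (φ ∧f C G g φ))
    RC1  : ∀ G (g : 𝒢 G) {φ ψ} → Thm (φ ⇒ E G g (ψ ∧f φ)) → Thm (φ ⇒ C G g ψ)

  record Kripke (ℓ : Level) : Set (lsuc ℓ) where
    field
      S  : Set ℓ
      π  : S → Φ → Bool
      𝒦  : A → S → S → Set ℓ

  module _ {ℓ : Level} (M : Kripke ℓ) where
    open Kripke M

    EG : Pred A 0ℓ → (S → Set ℓ) → S → Set ℓ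
    EG G P s = ∀ i → G i → ∀ t → 𝒦 i s t → P t

    -- E_G^k, k ≥ 1 :  EGⁿ G n P = E_G^(n+1) P
    EGⁿ : Pred A 0ℓ → ℕ → (S → Set ℓ) → S → Set ℓ
    EGⁿ G zero    P = EG G P
    EGⁿ G (suc n) P = EG G (EGⁿ G n P)

    sat : Formula → S → Set ℓ
    sat (prim p)   s = Lift ℓ (T (π s p))
    sat (φ ∧f ψ)   s = sat φ s × sat ψ s
    sat (¬f φ)     s = sat φ s → Lift ℓ ⊥
    sat (K i φ)    s = ∀ t → 𝒦 i s t → sat φ t
    sat (E G g φ)  s = EG G (sat φ) s
    sat (C G g φ)  s = ∀ (k : ℕ) → EGⁿ G k (sat φ) s

  Valid : (ℓ : Level) → Formula → Set (lsuc ℓ)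
  Valid ℓ φ = (M : Kripke ℓ) (s : Kripke.S M) → sat M φ s

-- Completeness is proved with a finite canonical model for ψ₀. Its states are the consistent
-- atoms, i.e. truth assignments w to the closure of ψ₀ (subformulas, plus E_G (φ ∧ C_G φ) for each
-- C_G φ) whose characteristic conjunction ⌜ w ⌝ is consistent, and agent i sees u from w when u
-- contains every φ that w "tells i": K_i φ, or E_G φ with i ∈ G. Since the atoms cover all cases
-- (⊢ ⋁ ⌜ w ⌝), ψ₀ is provable once it belongs to every consistent atom, which is the truth lemma.
-- Its K case is the usual argument: if every successor of w contains θ, then ⌜ w ⌝ ⊢ K_i θ. For
-- E_G the infinitely many agents of G must be covered by finitely many formulas for E2: an agent
-- not mentioned in ψ₀ learns only through mentioned groups, so it is represented by the
-- intersection of the mentioned groups containing it, which lies in 𝒢 by closure under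
-- intersection. For C_G the disjunction of the atoms G-reachable from w is an invariant to which
-- RC1 applies.

module Submission where

open import Axiom.ExcludedMiddle using (ExcludedMiddle)
open import Data.Bool using (Bool; true; false; not; T)
open import Data.Bool.Properties using (T-≡; T-∧)
open import Data.Empty using (⊥; ⊥-elim)
open import Data.Fin using (Fin)
open import Data.List using (List; []; _∷_; _++_; map; length; lookup; allFin; concatMap; filter)
open import Data.List.Membership.Propositional using (find; lose) renaming (_∈_ to _∈ₗ_)
open import Data.List.Membership.Propositional.Properties
  using (∈-++⁺ˡ; ∈-++⁺ʳ; ∈-++⁻; ∈-map⁺; ∈-allFin; ∈-filter⁺; ∈-filter⁻; ∈-concatMap⁺; ∈-concatMap⁻)
open import Data.List.Relation.Unary.All as All using (All; []; _∷_)
open import Data.List.Relation.Unary.All.Properties as All using (All¬⇒¬Any; ¬All⇒Any¬)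
open import Data.List.Relation.Unary.Any as Any using (Any; here; there)
open import Data.List.Relation.Unary.Any.Properties as Any using (lookup-index)
open import Data.Nat using (ℕ; zero; suc)
open import Data.Product using (_×_; Σ; _,_; proj₁; proj₂)
open import Data.Sum using (_⊎_; inj₁; inj₂)
open import Data.Unit.Polymorphic using (⊤)
open import Data.Vec as Vec using (Vec; _∷_; [])
open import Data.Vec.Properties as Vec using (lookup∘tabulate)
open import Function using (_∘_)
open import Function.Bundles using (_⇔_; mk⇔; module Equivalence)
open import Level using (Level; 0ℓ; _⊔_; Lift; lift; lower) renaming (suc to lsuc)
open import Relation.Binary.Construct.Closure.Transitive using (TransClosure; [_]; _∷_; _∷ʳ_)
open import Relation.Binary.PropositionalEquality using (_≡_; refl; sym; cong; cong₂; subst)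
open import Relation.Nullary using (Dec; yes; no; ¬_)
open import Relation.Nullary.Decidable
  using (True; isYes; toWitness; fromWitness; decidable-stable; T?; ¬?; _×-dec_)
open import Relation.Unary using (Pred; Satisfiable; _∩_; ∁; _∈_)

open import Defs

open Equivalence using (to; from)

T-not : ∀ {b} → T (not b) ⇔ (¬ T b)
T-not {false} = mk⇔ (λ _ ()) (λ _ → _)
T-not {true}  = mk⇔ (λ ()) (λ ¬t → ¬t _)

module Soundness (lem : ∀ {l} → ExcludedMiddle l) (A Φ : Set) (𝒢 : Pred (Pred A 0ℓ) 0ℓ) where
  open Logic A Φ 𝒢

  module _ {ℓ : Level} (M : Kripke ℓ) where
    open Kripke M

    ⇒-intro : ∀ {φ ψ s} → (sat M φ s → sat M ψ s) → sat M (φ ⇒ ψ) s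
    ⇒-intro f (x , ¬y) = ¬y (f x)

    ⇒-elim : ∀ {φ ψ s} → sat M (φ ⇒ ψ) s → sat M φ s → sat M ψ s
    ⇒-elim {ψ = ψ} {s} h x with lem {P = sat M ψ s}
    ... | yes y = y
    ... | no ¬y = ⊥-elim (lower (h (x , λ y → ⊥-elim (¬y y))))

    sat-inst : ∀ σ s τ → sat M (inst σ τ) s ⇔ T (peval (λ n → isYes (lem {P = sat M (σ n) s})) τ)
    sat-inst σ s (pvar n)   = mk⇔ fromWitness toWitness
    sat-inst σ s (pand a b) = mk⇔
      (λ (x , y) → from T-∧ (to (sat-inst σ s a) x , to (sat-inst σ s b) y))
      (λ t → from (sat-inst σ s a) (proj₁ (to T-∧ t)) , from (sat-inst σ s b) (proj₂ (to T-∧ t)))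
    sat-inst σ s (pneg a)   = mk⇔
      (λ h → from T-not (λ t → lower (h (from (sat-inst σ s a) t))))
      (λ t x → lift (to T-not t (to (sat-inst σ s a) x)))

    sat-⋀ : ∀ {d L s} → sat M (⋀ d L) s → All (λ φ → sat M φ s) L
    sat-⋀ {L = []}         h = []
    sat-⋀ {L = φ ∷ []}     h = h ∷ []
    sat-⋀ {L = φ ∷ ψ ∷ L}  (x , h) = x ∷ sat-⋀ {L = ψ ∷ L} h

    sound : ∀ {φ} → Thm φ → ∀ s → sat M φ s
    sound (Prop τ taut σ) s = from (sat-inst σ s τ) (from T-≡ (taut _))
    sound (K1 i φ ψ) s = ⇒-intro {K i φ ∧f K i (φ ⇒ ψ)} {K i ψ}
      λ (kφ , kφψ) t r → ⇒-elim {φ} {ψ} (kφψ t r) (kφ t r)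
    sound (MP {φ} {ψ} p q) s = ⇒-elim {φ} {ψ} (sound q s) (sound p s)
    sound (KGen i p) s t r = sound p t
    sound (E1 G g φ i i∈G) s = ⇒-intro {E G g φ} {K i φ} λ e → e i i∈G
    sound (E2 G g φ A′ 𝒢′ cover) s = ⇒-intro {_} {E G g φ} λ h i i∈G → everyone (sat-⋀ h) i (cover i i∈G)
      where
      everyone : All (λ χ → sat M χ s) (map (λ i → K i φ) A′ ++ map (λ H → E (proj₁ H) (proj₂ H) φ) 𝒢′) →
                 ∀ i → (i ∈ₗ A′) ⊎ Any (λ H → proj₁ H i) 𝒢′ → ∀ t → 𝒦 i s t → sat M φ t
      everyone hs i (inj₁ i∈A′) = All.lookup hs (∈-++⁺ˡ (∈-map⁺ (λ i → K i φ) i∈A′))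
      everyone hs i (inj₂ i∈H) with find i∈H
      ... | H , H∈𝒢′ , i∈H′ =
        All.lookup hs (∈-++⁺ʳ (map (λ i → K i φ) A′) (∈-map⁺ (λ H → E (proj₁ H) (proj₂ H) φ) H∈𝒢′)) i i∈H′
    sound (E3 G g φ ψ) s = ⇒-intro {E G g φ ∧f E G g (φ ⇒ ψ)} {E G g ψ}
      λ (eφ , eφψ) i i∈G t r → ⇒-elim {φ} {ψ} (eφψ i i∈G t r) (eφ i i∈G t r)
    sound (EGen G g p) s i i∈G t r = sound p t
    sound (C1 G g φ) s = ⇒-intro {C G g φ} {E G g (φ ∧f C G g φ)}
      λ c i i∈G t r → c 0 i i∈G t r , λ k → c (suc k) i i∈G t r
    sound (RC1 G g {φ} {ψ} p) s = ⇒-intro {φ} {C G g ψ} λ x k → iterate k s x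
      where
      iterate : ∀ k s → sat M φ s → EGⁿ M G k (sat M ψ) s
      iterate zero    s x i i∈G t r = proj₁ (⇒-elim {φ} {E G g (ψ ∧f φ)} (sound p s) x i i∈G t r)
      iterate (suc k) s x i i∈G t r = iterate k t (proj₂ (⇒-elim {φ} {E G g (ψ ∧f φ)} (sound p s) x i i∈G t r))

-- Φ may be empty, so closed formulas such as ⊤ are built from an arbitrary given formula τ₀.
module Reasoning (lem : ∀ {l} → ExcludedMiddle l) (A Φ : Set) (𝒢 : Pred (Pred A 0ℓ) 0ℓ)
                 (τ₀ : Logic.Formula A Φ 𝒢) where
  open Logic A Φ 𝒢

  ⟦_⟧ : Formula → (Formula → Bool) → Set
  ⟦ φ ∧f ψ ⟧ f = ⟦ φ ⟧ f × ⟦ ψ ⟧ f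
  ⟦ ¬f φ ⟧   f = ¬ ⟦ φ ⟧ f
  ⟦ φ ⟧      f = T (f φ)

  ⟦_⟧? : ∀ φ f → Dec (⟦ φ ⟧ f)
  ⟦ φ ∧f ψ ⟧? f = ⟦ φ ⟧? f ×-dec ⟦ ψ ⟧? f
  ⟦ ¬f φ ⟧?   f = ¬? (⟦ φ ⟧? f)
  ⟦ prim p ⟧?  f = T? _
  ⟦ K i φ ⟧?   f = T? _
  ⟦ E G g φ ⟧? f = T? _
  ⟦ C G g φ ⟧? f = T? _

  module _ {φ ψ : Formula} {f : Formula → Bool} where
    ⟦⇒⟧-intro : (⟦ φ ⟧ f → ⟦ ψ ⟧ f) → ⟦ φ ⇒ ψ ⟧ f
    ⟦⇒⟧-intro h (x , ¬y) = ¬y (h x)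

    ⟦⇒⟧-elim : ⟦ φ ⇒ ψ ⟧ f → ⟦ φ ⟧ f → ⟦ ψ ⟧ f
    ⟦⇒⟧-elim h x = decidable-stable (⟦ ψ ⟧? f) (λ ¬y → h (x , ¬y))

  atomsOf : Formula → List Formula
  atomsOf (φ ∧f ψ) = atomsOf φ ++ atomsOf ψ
  atomsOf (¬f φ)   = atomsOf φ
  atomsOf φ        = φ ∷ []

  position : List Formula → Formula → ℕ
  position []      φ = 0
  position (ψ ∷ L) φ with lem {P = ψ ≡ φ}
  ... | yes _ = 0
  ... | no  _ = suc (position L φ)

  nth : List Formula → ℕ → Formula
  nth []      n       = τ₀
  nth (ψ ∷ L) zero    = ψ
  nth (ψ ∷ L) (suc n) = nth L n

  nth-position : ∀ {φ} L → φ ∈ₗ L → nth L (position L φ) ≡ φ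
  nth-position {φ} (ψ ∷ L) φ∈L with lem {P = ψ ≡ φ} | φ∈L
  ... | yes ψ≡φ | _         = ψ≡φ
  ... | no  ψ≢φ | here φ≡ψ  = ⊥-elim (ψ≢φ (sym φ≡ψ))
  ... | no  _   | there φ∈L = nth-position L φ∈L

  skeleton : List Formula → Formula → PForm
  skeleton L (φ ∧f ψ) = pand (skeleton L φ) (skeleton L ψ)
  skeleton L (¬f φ)   = pneg (skeleton L φ)
  skeleton L φ        = pvar (position L φ)

  inst-skeleton : ∀ L φ → (∀ {ψ} → ψ ∈ₗ atomsOf φ → ψ ∈ₗ L) → inst (nth L) (skeleton L φ) ≡ φ
  inst-skeleton L (φ ∧f ψ) ⊆L = cong₂ _∧f_ (inst-skeleton L φ (⊆L ∘ ∈-++⁺ˡ))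
                                          (inst-skeleton L ψ (⊆L ∘ ∈-++⁺ʳ (atomsOf φ)))
  inst-skeleton L (¬f φ)   ⊆L = cong ¬f_ (inst-skeleton L φ ⊆L)
  inst-skeleton L (prim p)  ⊆L = nth-position L (⊆L (here refl))
  inst-skeleton L (K i φ)   ⊆L = nth-position L (⊆L (here refl))
  inst-skeleton L (E G g φ) ⊆L = nth-position L (⊆L (here refl))
  inst-skeleton L (C G g φ) ⊆L = nth-position L (⊆L (here refl))

  peval-skeleton : ∀ v L φ → T (peval v (skeleton L φ)) ⇔ ⟦ φ ⟧ (v ∘ position L)
  peval-skeleton v L (φ ∧f ψ) = mk⇔
    (λ t → to (peval-skeleton v L φ) (proj₁ (to T-∧ t)) , to (peval-skeleton v L ψ) (proj₂ (to T-∧ t)))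
    (λ (x , y) → from T-∧ (from (peval-skeleton v L φ) x , from (peval-skeleton v L ψ) y))
  peval-skeleton v L (¬f φ) = mk⇔
    (λ t x → to T-not t (from (peval-skeleton v L φ) x))
    (λ ¬x → from T-not (¬x ∘ to (peval-skeleton v L φ)))
  peval-skeleton v L (prim p)  = mk⇔ (λ t → t) (λ t → t)
  peval-skeleton v L (K i φ)   = mk⇔ (λ t → t) (λ t → t)
  peval-skeleton v L (E G g φ) = mk⇔ (λ t → t) (λ t → t)
  peval-skeleton v L (C G g φ) = mk⇔ (λ t → t) (λ t → t)

  -- φ is the instance of its propositional skeleton, in which equal atoms share a variable.
  tautology : ∀ {φ} → (∀ f → ⟦ φ ⟧ f) → Thm φ
  tautology {φ} valid = subst Thm (inst-skeleton (atomsOf φ) φ (λ ψ∈ → ψ∈))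
    (Prop (skeleton (atomsOf φ) φ)
          (λ v → to T-≡ (from (peval-skeleton v (atomsOf φ) φ) (valid _)))
          (nth (atomsOf φ)))

  _⊨ᵇ_ : List Formula → Formula → Set₁
  Γ ⊨ᵇ φ = ∀ f → All (λ γ → ⟦ γ ⟧ f) Γ → ⟦ φ ⟧ f

  consequence : ∀ {Γ φ} → Γ ⊨ᵇ φ → All Thm Γ → Thm φ
  consequence         Γ⊨φ []       = tautology (λ f → Γ⊨φ f [])
  consequence {γ ∷ Γ} {φ} Γ⊨φ (p ∷ ps) =
    MP p (consequence {Γ} (λ f γs → ⟦⇒⟧-intro {γ} {φ} (λ x → Γ⊨φ f (x ∷ γs))) ps)

  ⊤f : Formula
  ⊤f = τ₀ ⇒ τ₀

  ⟦⊤f⟧ : ∀ f → ⟦ ⊤f ⟧ f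
  ⟦⊤f⟧ f = ⟦⇒⟧-intro {τ₀} {τ₀} (λ x → x)

  conj : List Formula → Formula
  conj = ⋀ ⊤f

  ⋁ : List Formula → Formula
  ⋁ L = ¬f conj (map ¬f_ L)

  module _ {f : Formula → Bool} where
    ⟦⋀⟧⁺ : ∀ d L → ⟦ d ⟧ f → All (λ φ → ⟦ φ ⟧ f) L → ⟦ ⋀ d L ⟧ f
    ⟦⋀⟧⁺ d []          x []       = x
    ⟦⋀⟧⁺ d (φ ∷ [])    _ (y ∷ []) = y
    ⟦⋀⟧⁺ d (φ ∷ ψ ∷ L) x (y ∷ ys) = y , ⟦⋀⟧⁺ d (ψ ∷ L) x ys

    ⟦⋀⟧⁻ : ∀ d L → ⟦ ⋀ d L ⟧ f → All (λ φ → ⟦ φ ⟧ f) L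
    ⟦⋀⟧⁻ d []          _       = []
    ⟦⋀⟧⁻ d (φ ∷ [])    y       = y ∷ []
    ⟦⋀⟧⁻ d (φ ∷ ψ ∷ L) (y , x) = y ∷ ⟦⋀⟧⁻ d (ψ ∷ L) x

    ⟦⋁⟧⁺ : ∀ L → Any (λ φ → ⟦ φ ⟧ f) L → ⟦ ⋁ L ⟧ f
    ⟦⋁⟧⁺ L some none = All¬⇒¬Any (All.map⁻ (⟦⋀⟧⁻ ⊤f (map ¬f_ L) none)) some

    ⟦⋁⟧⁻ : ∀ L → ⟦ ⋁ L ⟧ f → Any (λ φ → ⟦ φ ⟧ f) L
    ⟦⋁⟧⁻ L h = Any.map (λ {φ} → decidable-stable (⟦ φ ⟧? f))
      (¬All⇒Any¬ (λ φ → ¬? (⟦ φ ⟧? f)) L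
        (λ none → h (⟦⋀⟧⁺ ⊤f (map ¬f_ L) (⟦⊤f⟧ f) (All.map⁺ none))))

  ⇒-trans : ∀ {φ ψ χ} → Thm (φ ⇒ ψ) → Thm (ψ ⇒ χ) → Thm (φ ⇒ χ)
  ⇒-trans {φ} {ψ} {χ} p q = consequence
    (λ { f (pq ∷ qr ∷ []) → ⟦⇒⟧-intro {φ} {χ} (⟦⇒⟧-elim {ψ} {χ} qr ∘ ⟦⇒⟧-elim {φ} {ψ} pq) })
    (p ∷ q ∷ [])

  ⇒-∧ : ∀ {φ ψ χ} → Thm (φ ⇒ ψ) → Thm (φ ⇒ χ) → Thm (φ ⇒ ψ ∧f χ)
  ⇒-∧ {φ} {ψ} {χ} p q = consequence
    (λ { f (pψ ∷ pχ ∷ []) →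
         ⟦⇒⟧-intro {φ} {ψ ∧f χ} (λ x → ⟦⇒⟧-elim {φ} {ψ} pψ x , ⟦⇒⟧-elim {φ} {χ} pχ x) })
    (p ∷ q ∷ [])

  ⇒-proj₁ : ∀ {φ ψ χ} → Thm (φ ⇒ ψ ∧f χ) → Thm (φ ⇒ ψ)
  ⇒-proj₁ {φ} {ψ} {χ} p = consequence
    (λ { f (h ∷ []) → ⟦⇒⟧-intro {φ} {ψ} (proj₁ ∘ ⟦⇒⟧-elim {φ} {ψ ∧f χ} h) }) (p ∷ [])

  ⇒-proj₂ : ∀ {φ ψ χ} → Thm (φ ⇒ ψ ∧f χ) → Thm (φ ⇒ χ)
  ⇒-proj₂ {φ} {ψ} {χ} p = consequence
    (λ { f (h ∷ []) → ⟦⇒⟧-intro {φ} {χ} (proj₂ ∘ ⟦⇒⟧-elim {φ} {ψ ∧f χ} h) }) (p ∷ [])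

  ⇒-refute : ∀ {φ ψ} → Thm (φ ⇒ ¬f ψ) → Thm (φ ⇒ ψ) → Thm (¬f φ)
  ⇒-refute {φ} {ψ} p q = consequence
    (λ { f (p¬ψ ∷ pψ ∷ []) x → ⟦⇒⟧-elim {φ} {¬f ψ} p¬ψ x (⟦⇒⟧-elim {φ} {ψ} pψ x) }) (p ∷ q ∷ [])

  ⇒-weaken : ∀ {φ ψ χ} → Thm (φ ⇒ ψ) → Thm (φ ⇒ (χ ⇒ ψ))
  ⇒-weaken {φ} {ψ} {χ} p = consequence
    (λ { f (h ∷ []) → ⟦⇒⟧-intro {φ} {χ ⇒ ψ} (λ x → ⟦⇒⟧-intro {χ} {ψ} (λ _ → ⟦⇒⟧-elim {φ} {ψ} h x)) })
    (p ∷ [])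

  ⇒-clash : ∀ {φ ψ χ θ} → Thm (φ ⇒ ¬f ψ) → Thm (χ ⇒ ψ) → Thm (φ ⇒ (χ ⇒ θ))
  ⇒-clash {φ} {ψ} {χ} {θ} p q = consequence
    (λ { f (p¬ψ ∷ qψ ∷ []) → ⟦⇒⟧-intro {φ} {χ ⇒ θ} (λ x → ⟦⇒⟧-intro {χ} {θ} (λ y →
         ⊥-elim (⟦⇒⟧-elim {φ} {¬f ψ} p¬ψ x (⟦⇒⟧-elim {χ} {ψ} qψ y)))) }) (p ∷ q ∷ [])

  ⇒-refl : ∀ {φ} → Thm (φ ⇒ φ)
  ⇒-refl {φ} = tautology (λ f → ⟦⇒⟧-intro {φ} {φ} (λ x → x))

  ⇒-const : ∀ {φ ψ} → Thm ψ → Thm (φ ⇒ ψ)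
  ⇒-const {φ} {ψ} p = consequence (λ { f (x ∷ []) → ⟦⇒⟧-intro {φ} {ψ} (λ _ → x) }) (p ∷ [])

  ¬⇒ : ∀ {φ ψ} → Thm (¬f φ) → Thm (φ ⇒ ψ)
  ¬⇒ {φ} {ψ} p = consequence
    (λ { f (¬φ ∷ []) → ⟦⇒⟧-intro {φ} {ψ} (⊥-elim ∘ ¬φ) }) (p ∷ [])

  ⋀-∈ : ∀ {d L φ} → φ ∈ₗ L → Thm (⋀ d L ⇒ φ)
  ⋀-∈ {d} {L} {φ} φ∈L = tautology (λ f → ⟦⇒⟧-intro {⋀ d L} {φ} (λ x → All.lookup (⟦⋀⟧⁻ d L x) φ∈L))

  ⋀-intro : ∀ {φ d} L → Thm (φ ⇒ d) → All (λ ψ → Thm (φ ⇒ ψ)) L → Thm (φ ⇒ ⋀ d L)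
  ⋀-intro []          p []       = p
  ⋀-intro (ψ ∷ [])    p (q ∷ []) = q
  ⋀-intro (ψ ∷ χ ∷ L) p (q ∷ qs) = ⇒-∧ q (⋀-intro (χ ∷ L) p qs)

  ⋁-∈ : ∀ {L φ} → φ ∈ₗ L → Thm (φ ⇒ ⋁ L)
  ⋁-∈ {L} {φ} φ∈L = tautology (λ f → ⟦⇒⟧-intro {φ} {⋁ L} (λ x → ⟦⋁⟧⁺ L (Any.map (λ { refl → x }) φ∈L)))

  ⋁-elim : ∀ {ψ} L → All (λ φ → Thm (φ ⇒ ψ)) L → Thm (⋁ L ⇒ ψ)
  ⋁-elim {ψ} L ps = consequence {Γ = map (_⇒ ψ) L} semantic (All.map⁺ ps)
    where
    semantic : map (_⇒ ψ) L ⊨ᵇ (⋁ L ⇒ ψ)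
    semantic f hs = ⟦⇒⟧-intro {⋁ L} {ψ} λ h →
      let (φ , φ∈L , x) = find (⟦⋁⟧⁻ L h) in ⟦⇒⟧-elim {φ} {ψ} (All.lookup (All.map⁻ hs) φ∈L) x

  record Normal (□ : Formula → Formula) : Set₁ where
    field
      necessitation : ∀ {φ} → Thm φ → Thm (□ φ)
      distribution  : ∀ φ ψ → Thm ((□ φ ∧f □ (φ ⇒ ψ)) ⇒ □ ψ)

  module _ {□ : Formula → Formula} (N : Normal □) where
    open Normal N

    □-mono : ∀ {φ ψ} → Thm (φ ⇒ ψ) → Thm (□ φ ⇒ □ ψ)
    □-mono {φ} {ψ} p = consequence
      (λ { f (d ∷ n ∷ []) →
           ⟦⇒⟧-intro {□ φ} {□ ψ} (λ x → ⟦⇒⟧-elim {□ φ ∧f □ (φ ⇒ ψ)} {□ ψ} d (x , n)) })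
      (distribution φ ψ ∷ necessitation p ∷ [])

    □-∧ : ∀ {χ φ ψ} → Thm (χ ⇒ □ φ) → Thm (χ ⇒ □ ψ) → Thm (χ ⇒ □ (φ ∧f ψ))
    □-∧ {χ} {φ} {ψ} p q = ⇒-trans (⇒-∧ q (⇒-trans p (□-mono pair))) (distribution ψ (φ ∧f ψ))
      where
      pair : Thm (φ ⇒ (ψ ⇒ φ ∧f ψ))
      pair = tautology (λ f → ⟦⇒⟧-intro {φ} {ψ ⇒ φ ∧f ψ} (λ x → ⟦⇒⟧-intro {ψ} {φ ∧f ψ} (x ,_)))

    □-conj : ∀ {χ} L → All (λ φ → Thm (χ ⇒ □ φ)) L → Thm (χ ⇒ □ (conj L))
    □-conj []          []       = ⇒-const (necessitation (tautology ⟦⊤f⟧))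
    □-conj (φ ∷ [])    (p ∷ []) = p
    □-conj (φ ∷ ψ ∷ L) (p ∷ ps) = □-∧ p (□-conj (ψ ∷ L) ps)

  K-normal : ∀ i → Normal (K i)
  K-normal i = record { necessitation = KGen i ; distribution = K1 i }

  E-normal : ∀ G g → Normal (E G g)
  E-normal G g = record { necessitation = EGen G g ; distribution = E3 G g }

allVecs : ∀ m → List (Vec Bool m)
allVecs zero    = [] ∷ []
allVecs (suc m) = map (true ∷_) (allVecs m) ++ map (false ∷_) (allVecs m)

∈-allVecs : ∀ {m} (v : Vec Bool m) → v ∈ₗ allVecs m
∈-allVecs []          = here refl
∈-allVecs (true ∷ v)  = ∈-++⁺ˡ (∈-map⁺ (true ∷_) (∈-allVecs v))
∈-allVecs {suc m} (false ∷ v) = ∈-++⁺ʳ (map (true ∷_) (allVecs m)) (∈-map⁺ (false ∷_) (∈-allVecs v))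

module Closure (A Φ : Set) (𝒢 : Pred (Pred A 0ℓ) 0ℓ) where
  open Logic A Φ 𝒢

  closure : Formula → List Formula
  closure (prim p)  = prim p ∷ []
  closure (φ ∧f ψ)  = (φ ∧f ψ) ∷ closure φ ++ closure ψ
  closure (¬f φ)    = ¬f φ ∷ closure φ
  closure (K i φ)   = K i φ ∷ closure φ
  closure (E G g φ) = E G g φ ∷ closure φ
  closure (C G g φ) = C G g φ ∷ E G g (φ ∧f C G g φ) ∷ (φ ∧f C G g φ) ∷ closure φ

  ChildrenIn : List Formula → Formula → Set₁
  ChildrenIn L (prim p)  = ⊤
  ChildrenIn L (φ ∧f ψ)  = φ ∈ₗ L × ψ ∈ₗ L
  ChildrenIn L (¬f φ)    = φ ∈ₗ L
  ChildrenIn L (K i φ)   = φ ∈ₗ L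
  ChildrenIn L (E G g φ) = φ ∈ₗ L
  ChildrenIn L (C G g φ) = φ ∈ₗ L × E G g (φ ∧f C G g φ) ∈ₗ L

  ChildrenIn-mono : ∀ {L L′} φ → (∀ {ψ} → ψ ∈ₗ L → ψ ∈ₗ L′) → ChildrenIn L φ → ChildrenIn L′ φ
  ChildrenIn-mono (prim p)  ⊆ _       = _
  ChildrenIn-mono (φ ∧f ψ)  ⊆ (x , y) = ⊆ x , ⊆ y
  ChildrenIn-mono (¬f φ)    ⊆ x       = ⊆ x
  ChildrenIn-mono (K i φ)   ⊆ x       = ⊆ x
  ChildrenIn-mono (E G g φ) ⊆ x       = ⊆ x
  ChildrenIn-mono (C G g φ) ⊆ (x , y) = ⊆ x , ⊆ y

  ∈-closure : ∀ φ → φ ∈ₗ closure φ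
  ∈-closure (prim p)  = here refl
  ∈-closure (φ ∧f ψ)  = here refl
  ∈-closure (¬f φ)    = here refl
  ∈-closure (K i φ)   = here refl
  ∈-closure (E G g φ) = here refl
  ∈-closure (C G g φ) = here refl

  closure-closed : ∀ ψ {φ} → φ ∈ₗ closure ψ → ChildrenIn (closure ψ) φ
  closure-closed (prim p)  (here refl) = _
  closure-closed (φ ∧f ψ)  (here refl) =
    there (∈-++⁺ˡ (∈-closure φ)) , there (∈-++⁺ʳ (closure φ) (∈-closure ψ))
  closure-closed (φ ∧f ψ) {χ} (there χ∈) with ∈-++⁻ (closure φ) χ∈
  ... | inj₁ χ∈φ = ChildrenIn-mono χ (there ∘ ∈-++⁺ˡ) (closure-closed φ χ∈φ)
  ... | inj₂ χ∈ψ = ChildrenIn-mono χ (there ∘ ∈-++⁺ʳ (closure φ)) (closure-closed ψ χ∈ψ)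
  closure-closed (¬f φ)    (here refl) = there (∈-closure φ)
  closure-closed (¬f φ) {χ} (there χ∈) = ChildrenIn-mono χ there (closure-closed φ χ∈)
  closure-closed (K i φ)   (here refl) = there (∈-closure φ)
  closure-closed (K i φ) {χ} (there χ∈) = ChildrenIn-mono χ there (closure-closed φ χ∈)
  closure-closed (E G g φ) (here refl) = there (∈-closure φ)
  closure-closed (E G g φ) {χ} (there χ∈) = ChildrenIn-mono χ there (closure-closed φ χ∈)
  closure-closed (C G g φ) (here refl) = there (there (there (∈-closure φ))) , there (here refl)
  closure-closed (C G g φ) (there (here refl)) = there (there (here refl))
  closure-closed (C G g φ) (there (there (here refl))) = there (there (there (∈-closure φ))) , here refl
  closure-closed (C G g φ) {χ} (there (there (there χ∈))) =
    ChildrenIn-mono χ (there ∘ there ∘ there) (closure-closed φ χ∈)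

module Canonical (lem : ∀ {l} → ExcludedMiddle l) (A Φ : Set) (𝒢 : Pred (Pred A 0ℓ) 0ℓ)
                 (ψ₀ : Logic.Formula A Φ 𝒢) where
  open Logic A Φ 𝒢
  open Closure A Φ 𝒢
  open Reasoning lem A Φ 𝒢 ψ₀ public

  cl : List Formula
  cl = closure ψ₀

  clAt : Fin (length cl) → Formula
  clAt = lookup cl

  Atom : Set
  Atom = Vec Bool (length cl)

  literal : Bool → Formula → Formula
  literal true  φ = φ
  literal false φ = ¬f φ

  literalAt : Atom → Fin (length cl) → Formula
  literalAt w j = literal (Vec.lookup w j) (clAt j)

  ⌜_⌝ : Atom → Formula
  ⌜ w ⌝ = conj (map (literalAt w) (allFin _))

  data Holds (w : Atom) (φ : Formula) : Set₁ where
    holds : ∀ j → clAt j ≡ φ → T (Vec.lookup w j) → Holds w φ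

  Consistent : Atom → Set₁
  Consistent w = ¬ Thm (¬f ⌜ w ⌝)

  ⌜⌝⇒literal : ∀ w j → Thm (⌜ w ⌝ ⇒ literalAt w j)
  ⌜⌝⇒literal w j = ⋀-∈ (∈-map⁺ (literalAt w) (∈-allFin j))

  Holds⇒ : ∀ {w φ} → Holds w φ → Thm (⌜ w ⌝ ⇒ φ)
  Holds⇒ {w} (holds j refl t) with Vec.lookup w j | ⌜⌝⇒literal w j
  ... | true | p = p

  ¬Holds⇒ : ∀ {w φ} → φ ∈ₗ cl → ¬ Holds w φ → Thm (⌜ w ⌝ ⇒ ¬f φ)
  ¬Holds⇒ {w} φ∈cl ¬h with Any.index φ∈cl | lookup-index φ∈cl
  ... | j | refl with Vec.lookup w j in wj | ⌜⌝⇒literal w j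
  ...   | true  | _ = ⊥-elim (¬h (holds j refl (subst T (sym wj) _)))
  ...   | false | p = p

  Thm⇒Holds : ∀ {w φ} → Consistent w → φ ∈ₗ cl → Thm (⌜ w ⌝ ⇒ φ) → Holds w φ
  Thm⇒Holds {w} {φ} c φ∈cl p with lem {P = Holds w φ}
  ... | yes h  = h
  ... | no  ¬h = ⊥-elim (c (⇒-refute (¬Holds⇒ {w} φ∈cl ¬h) p))

  allAtoms : List Atom
  allAtoms = allVecs (length cl)

  atoms-cover : Thm (⋁ (map ⌜_⌝ allAtoms))
  atoms-cover = tautology λ f →
    ⟦⋁⟧⁺ (map ⌜_⌝ allAtoms) (Any.map⁺ {xs = allAtoms} (lose (∈-allVecs (atomOf f)) (⟦atomOf⟧ f)))
    where
    atomOf : (Formula → Bool) → Atom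
    atomOf f = Vec.tabulate (λ j → isYes (⟦ clAt j ⟧? f))

    ⟦literal⟧ : ∀ f φ → ⟦ literal (isYes (⟦ φ ⟧? f)) φ ⟧ f
    ⟦literal⟧ f φ with ⟦ φ ⟧? f
    ... | yes x = x
    ... | no ¬x = ¬x

    ⟦atomOf⟧ : ∀ f → ⟦ ⌜ atomOf f ⌝ ⟧ f
    ⟦atomOf⟧ f = ⟦⋀⟧⁺ ⊤f (map (literalAt (atomOf f)) (allFin _)) (⟦⊤f⟧ f)
      (All.map⁺ (All.tabulate λ {j} _ →
        subst (λ b → ⟦ literal b (clAt j) ⟧ f) (sym (lookup∘tabulate _ j)) (⟦literal⟧ f (clAt j))))

  by-atoms : ∀ {ψ} → (∀ w → Consistent w → Thm (⌜ w ⌝ ⇒ ψ)) → Thm ψ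
  by-atoms {ψ} case = MP atoms-cover (⋁-elim (map ⌜_⌝ allAtoms) (All.map⁺ (All.tabulate λ {w} _ → atom-case w)))
    where
    atom-case : ∀ w → Thm (⌜ w ⌝ ⇒ ψ)
    atom-case w with lem {P = Thm (¬f ⌜ w ⌝)}
    ... | yes inconsistent = ¬⇒ inconsistent
    ... | no  consistent   = case w consistent

  data Source (a : A) (φ : Formula) : Formula → Set₁ where
    K-source : Source a φ (K a φ)
    E-source : ∀ {G} {g : 𝒢 G} → G a → Source a φ (E G g φ)

  onlyIf : ∀ {p} {P : Set p} → Dec P → Formula → List Formula
  onlyIf (yes _) φ = φ ∷ []
  onlyIf (no  _) φ = []

  known : A → Formula → List Formula
  known a (K b φ)   = onlyIf (lem {P = b ≡ a}) φ
  known a (E G g φ) = onlyIf (lem {P = G a}) φ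
  known a _         = []

  known-source : ∀ {a φ} χ → φ ∈ₗ known a χ → Source a φ χ
  known-source {a} (K b φ) φ∈ with lem {P = b ≡ a} | φ∈
  ... | yes refl | here refl = K-source
  known-source {a} (E G g φ) φ∈ with lem {P = G a} | φ∈
  ... | yes Ga | here refl = E-source Ga

  source-known : ∀ {a φ χ} → Source a φ χ → φ ∈ₗ known a χ
  source-known {a} K-source with lem {P = a ≡ a}
  ... | yes _  = here refl
  ... | no a≢a = ⊥-elim (a≢a refl)
  source-known {a} (E-source {G} Ga) with lem {P = G a}
  ... | yes _ = here refl
  ... | no ¬Ga = ⊥-elim (¬Ga Ga)

  knowledge : A → Atom → List Formula
  knowledge a w = concatMap (known a) (filter (λ χ → lem {P = Holds w χ}) cl)

  knowledge-source : ∀ {a w φ} → φ ∈ₗ knowledge a w → Σ Formula λ χ → χ ∈ₗ cl × Holds w χ × Source a φ χ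
  knowledge-source {a} {w} φ∈ with find (∈-concatMap⁻ (known a) φ∈)
  ... | χ , χ∈ , φ∈χ = let χ∈cl , h = ∈-filter⁻ (λ χ → lem) χ∈ in χ , χ∈cl , h , known-source χ φ∈χ

  source-knowledge : ∀ {a w φ χ} → χ ∈ₗ cl → Holds w χ → Source a φ χ → φ ∈ₗ knowledge a w
  source-knowledge {a} χ∈cl h s =
    ∈-concatMap⁺ (known a) (lose (∈-filter⁺ (λ χ → lem) χ∈cl h) (source-known s))

  knowledge-⊆cl : ∀ {a w φ} → φ ∈ₗ knowledge a w → φ ∈ₗ cl
  knowledge-⊆cl φ∈ with knowledge-source φ∈
  ... | _ , χ∈cl , _ , K-source   = closure-closed ψ₀ χ∈cl
  ... | _ , χ∈cl , _ , E-source _ = closure-closed ψ₀ χ∈cl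

  knowledge⇒K : ∀ {a w φ} → φ ∈ₗ knowledge a w → Thm (⌜ w ⌝ ⇒ K a φ)
  knowledge⇒K {a} φ∈ with knowledge-source φ∈
  ... | _ , _ , h , K-source              = Holds⇒ h
  ... | _ , _ , h , E-source {G} {g} Ga = ⇒-trans (Holds⇒ h) (E1 G g _ a Ga)

  Succ : A → Atom → Atom → Set₁
  Succ a w u = All (Holds u) (knowledge a w)

  □-intro : ∀ {□} → Normal □ → ∀ a w θ →
            All (λ φ → Thm (⌜ w ⌝ ⇒ □ φ)) (knowledge a w) →
            (∀ u → Consistent u → Succ a w u → Thm (⌜ u ⌝ ⇒ θ)) →
            Thm (⌜ w ⌝ ⇒ □ θ)
  □-intro N a w θ known⇒□ succ⇒θ = ⇒-trans (□-conj N _ known⇒□) (□-mono N (by-atoms knowledge⇒θ))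
    where
    knowledge⇒θ : ∀ u → Consistent u → Thm (⌜ u ⌝ ⇒ (conj (knowledge a w) ⇒ θ))
    knowledge⇒θ u c with lem {P = Succ a w u}
    ... | yes s = ⇒-weaken (succ⇒θ u c s)
    ... | no ¬s with find (¬All⇒Any¬ (λ _ → lem) (knowledge a w) ¬s)
    ...   | φ , φ∈ , ¬h = ⇒-clash (¬Holds⇒ {u} (knowledge-⊆cl φ∈) ¬h) (⋀-∈ φ∈)

module Meets (lem : ∀ {l} → ExcludedMiddle l) {A : Set} (𝒢 : Pred (Pred A 0ℓ) 0ℓ)
  (𝒢-resp : ∀ {G H} → (∀ a → (G a → H a) × (H a → G a)) → 𝒢 G → 𝒢 H)
  (𝒢-∩ : ∀ {G H} → 𝒢 G → 𝒢 H → Satisfiable (G ∩ H) → 𝒢 (G ∩ H)) where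

  Group : Set₁
  Group = Σ (Pred A 0ℓ) 𝒢

  ⋂∋ : List Group → A → Pred A 0ℓ
  ⋂∋ []      b x = ⊤
  ⋂∋ (H ∷ L) b x = (proj₁ H b → proj₁ H x) × ⋂∋ L b x

  ⋂∋-refl : ∀ L b → ⋂∋ L b b
  ⋂∋-refl []      b = _
  ⋂∋-refl (H ∷ L) b = (λ Hb → Hb) , ⋂∋-refl L b

  ⋂∋-⊆ : ∀ {L H b x} → H ∈ₗ L → proj₁ H b → ⋂∋ L b x → proj₁ H x
  ⋂∋-⊆ (here refl) Hb (H⇒ , _) = H⇒ Hb
  ⋂∋-⊆ (there H∈) Hb (_ , ⋂L) = ⋂∋-⊆ H∈ Hb ⋂L

  ⋂∋-vacuous : ∀ L {b} → ¬ Any (λ H → proj₁ H b) L → ∀ x → ⋂∋ L b x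
  ⋂∋-vacuous []      _    x = _
  ⋂∋-vacuous (H ∷ L) none x = (λ Hb → ⊥-elim (none (here Hb))) , ⋂∋-vacuous L (none ∘ there) x

  ⋂∋-∈𝒢 : ∀ L b → Any (λ H → proj₁ H b) L → 𝒢 (⋂∋ L b)
  ⋂∋-∈𝒢 (H ∷ L) b some with lem {P = proj₁ H b} | some
  ... | no ¬Hb | here Hb = ⊥-elim (¬Hb Hb)
  ... | no ¬Hb | there some′ =
        𝒢-resp (λ x → (λ ⋂x → (λ Hb → ⊥-elim (¬Hb Hb)) , ⋂x) , proj₂) (⋂∋-∈𝒢 L b some′)
  ... | yes Hb | _ with lem {P = Any (λ H′ → proj₁ H′ b) L}
  ...   | yes some′ = 𝒢-resp (λ x → (λ (Hx , ⋂x) → (λ _ → Hx) , ⋂x) , (λ (H⇒ , ⋂x) → H⇒ Hb , ⋂x))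
                             (𝒢-∩ (proj₂ H) (⋂∋-∈𝒢 L b some′) (b , Hb , ⋂∋-refl L b))
  ...   | no none   = 𝒢-resp (λ x → (λ Hx → (λ _ → Hx) , ⋂∋-vacuous L none x) , (λ (H⇒ , _) → H⇒ Hb))
                             (proj₂ H)

  profile : (L : List Group) → A → Vec Bool (length L)
  profile []      b = []
  profile (H ∷ L) b = isYes (lem {P = proj₁ H b}) ∷ profile L b

  profile-⋂∋ : ∀ L {b b′} → profile L b ≡ profile L b′ → ⋂∋ L b b′
  profile-⋂∋ []      _  = _
  profile-⋂∋ (H ∷ L) eq =
    (λ Hb → toWitness (subst T (Vec.∷-injectiveˡ eq) (fromWitness Hb))) , profile-⋂∋ L (Vec.∷-injectiveʳ eq)

module Completeness (lem : ∀ {l} → ExcludedMiddle l) (A Φ : Set) (𝒢 : Pred (Pred A 0ℓ) 0ℓ)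
  (𝒢-resp : ∀ {G H} → (∀ a → (G a → H a) × (H a → G a)) → 𝒢 G → 𝒢 H)
  (𝒢-∩ : ∀ {G H} → 𝒢 G → 𝒢 H → Satisfiable (G ∩ H) → 𝒢 (G ∩ H))
  (ψ₀ : Logic.Formula A Φ 𝒢) where
  open Logic A Φ 𝒢
  open Closure A Φ 𝒢
  open Canonical lem A Φ 𝒢 ψ₀
  open Meets lem 𝒢 𝒢-resp 𝒢-∩ using (⋂∋; ⋂∋-⊆; ⋂∋-∈𝒢; profile; profile-⋂∋)

  agentsOf : Formula → List A
  agentsOf (K i _) = i ∷ []
  agentsOf _       = []

  groupsOf : Formula → List Group
  groupsOf (E G g _) = (G , g) ∷ []
  groupsOf _         = []

  mentionedAgents : List A
  mentionedAgents = concatMap agentsOf cl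

  mentionedGroups : List Group
  mentionedGroups = concatMap groupsOf cl

  K-mentioned : ∀ {a φ} → K a φ ∈ₗ cl → a ∈ₗ mentionedAgents
  K-mentioned K∈cl = ∈-concatMap⁺ agentsOf (lose K∈cl (here refl))

  E-mentioned : ∀ {G g φ} → E G g φ ∈ₗ cl → (G , g) ∈ₗ mentionedGroups
  E-mentioned E∈cl = ∈-concatMap⁺ groupsOf (lose E∈cl (here refl))

  module _ (G : Pred A 0ℓ) (g : 𝒢 G) where
    LG : List Group
    LG = (G , g) ∷ mentionedGroups

    -- The meet of the groups of LG containing b depends only on b's profile over LG, so finitely
    -- many representatives suffice to cover all unmentioned agents of G.
    Outsider : Set
    Outsider = Σ A λ b → G b × ¬ (b ∈ₗ mentionedAgents)

    representative : ∀ p → Dec (Σ Outsider λ o → profile LG (proj₁ o) ≡ p) → List Outsider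
    representative p (yes (o , _)) = o ∷ []
    representative p (no _)        = []

    representatives : List Outsider
    representatives = concatMap (λ p → representative p lem) (allVecs (length LG))

    meetOf : Outsider → Group
    meetOf (b , Gb , _) = ⋂∋ LG b , ⋂∋-∈𝒢 LG b (here Gb)

    insiders : List A
    insiders = filter (λ i → lem {P = G i}) mentionedAgents

    covered : ∀ a → G a → (a ∈ₗ insiders) ⊎
                           Any (λ H → proj₁ H a) (map meetOf representatives)
    covered a Ga with lem {P = a ∈ₗ mentionedAgents}
    ... | yes a∈ = inj₁ (∈-filter⁺ (λ i → lem) a∈ Ga)
    ... | no  a∉ = inj₂ (Any.map⁺ (Any.concatMap⁺ (λ p → representative p lem)
                                    (lose (∈-allVecs (profile LG a)) (represented lem))))
      where
      represented : (d : Dec (Σ Outsider λ o → profile LG (proj₁ o) ≡ profile LG a)) →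
                    Any (λ o → proj₁ (meetOf o) a) (representative (profile LG a) d)
      represented (yes (o , same)) = here (profile-⋂∋ LG same)
      represented (no none)        = ⊥-elim (none ((a , Ga , a∉) , refl))

    -- Every group through which b learns contains the meet, so E over the meet plays the role of
    -- K_b in □-intro.
    E-meet-intro : ∀ o w θ → (∀ u → Consistent u → Succ (proj₁ o) w u → Thm (⌜ u ⌝ ⇒ θ)) →
                   Thm (⌜ w ⌝ ⇒ E (proj₁ (meetOf o)) (proj₂ (meetOf o)) θ)
    E-meet-intro o@(b , Gb , b∉) w θ =
      □-intro (E-normal (proj₁ (meetOf o)) (proj₂ (meetOf o))) b w θ (All.tabulate known⇒E)
      where
      known⇒E : ∀ {φ} → φ ∈ₗ knowledge b w → Thm (⌜ w ⌝ ⇒ E (proj₁ (meetOf o)) (proj₂ (meetOf o)) φ)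
      known⇒E φ∈ with knowledge-source φ∈
      ... | _ , χ∈cl , _ , K-source = ⊥-elim (b∉ (K-mentioned χ∈cl))
      ... | _ , χ∈cl , h , E-source {H} {h′} Hb = ⇒-trans (Holds⇒ h)
            (E2 (proj₁ (meetOf o)) (proj₂ (meetOf o)) _ [] ((H , h′) ∷ [])
                (λ x ⋂x → inj₂ (here (⋂∋-⊆ {L = LG} {b = b} (there (E-mentioned χ∈cl)) Hb ⋂x))))

    E-intro : ∀ w θ → (∀ i → G i → ∀ u → Consistent u → Succ i w u → Thm (⌜ u ⌝ ⇒ θ)) →
              Thm (⌜ w ⌝ ⇒ E G g θ)
    E-intro w θ succ⇒θ = ⇒-trans
      (⋀-intro _ (⇒-const ⇒-refl)
        (All.++⁺ (All.map⁺ (All.tabulate K-part)) (All.map⁺ (All.map⁺ (All.tabulate E-part)))))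
      (E2 G g θ _ (map meetOf representatives) covered)
      where
      K-part : ∀ {i} → i ∈ₗ insiders → Thm (⌜ w ⌝ ⇒ K i θ)
      K-part {i} i∈ = □-intro (K-normal i) i w θ (All.tabulate knowledge⇒K)
        (succ⇒θ i (proj₂ (∈-filter⁻ (λ i → lem {P = G i}) {xs = mentionedAgents} i∈)))

      E-part : ∀ {o} → o ∈ₗ representatives → Thm (⌜ w ⌝ ⇒ E (proj₁ (meetOf o)) (proj₂ (meetOf o)) θ)
      E-part {o@(b , Gb , _)} _ = E-meet-intro o w θ (succ⇒θ b Gb)

  Step : Pred A 0ℓ → Atom → Atom → Set₁
  Step G u v = Σ A λ i → G i × Succ i u v × Consistent v

  Reach : Pred A 0ℓ → Atom → Atom → Set₁
  Reach G = TransClosure (Step G)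

  -- Consistency and succession are large propositions; deciding them into Bool keeps the
  -- states and accessibility relations of the canonical model in every universe.
  canonical : ∀ ℓ → Kripke ℓ
  canonical ℓ = record
    { S = Lift ℓ (Σ Atom λ w → True (lem {P = Consistent w}))
    ; π = λ s p → isYes (lem {P = Holds (proj₁ (lower s)) (prim p)})
    ; 𝒦 = λ i s t → Lift ℓ (True (lem {P = Succ i (proj₁ (lower s)) (proj₁ (lower t))}))
    }

  module _ {ℓ : Level} where
    M : Kripke ℓ
    M = canonical ℓ

    state : ∀ w → Consistent w → Kripke.S M
    state w c = lift (w , fromWitness c)

    reach-EGⁿ : ∀ {G P w v} c → Reach G w v → (∀ k → EGⁿ M G k P (lift (w , c))) → ∀ cv → P (state v cv)
    reach-EGⁿ c [ i , Gi , s , _ ]       h cv = h 0 i Gi (state _ cv) (lift (fromWitness s))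
    reach-EGⁿ c ((i , Gi , s , cu) ∷ r) h cv =
      reach-EGⁿ (fromWitness cu) r (λ k → h (suc k) i Gi (state _ cu) (lift (fromWitness s))) cv

    Truth : Formula → Set (lsuc 0ℓ ⊔ ℓ)
    Truth φ = ∀ w c → sat M φ (lift (w , c)) ⇔ Holds w φ

    truth-prim : ∀ p → Truth (prim p)
    truth-prim p w c = mk⇔ (toWitness ∘ lower) (lift ∘ fromWitness)

    truth-∧ : ∀ {φ ψ} → (φ ∧f ψ) ∈ₗ cl → Truth φ → Truth ψ → Truth (φ ∧f ψ)
    truth-∧ {φ} {ψ} m IHφ IHψ w c = mk⇔
      (λ (x , y) → Thm⇒Holds (toWitness c) m (⇒-∧ (Holds⇒ (to (IHφ w c) x)) (Holds⇒ (to (IHψ w c) y))))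
      (λ h → from (IHφ w c) (Thm⇒Holds (toWitness c) (proj₁ (closure-closed ψ₀ m)) (⇒-proj₁ (Holds⇒ h))) ,
             from (IHψ w c) (Thm⇒Holds (toWitness c) (proj₂ (closure-closed ψ₀ m)) (⇒-proj₂ {ψ = φ} (Holds⇒ h))))

    truth-¬ : ∀ {φ} → (¬f φ) ∈ₗ cl → Truth φ → Truth (¬f φ)
    truth-¬ {φ} m IH w c = mk⇔ sat⇒Holds Holds⇒sat
      where
      sat⇒Holds : sat M (¬f φ) (lift (w , c)) → Holds w (¬f φ)
      sat⇒Holds ¬x with lem {P = Holds w φ}
      ... | yes h  = ⊥-elim (lower (¬x (from (IH w c) h)))
      ... | no  ¬h = Thm⇒Holds (toWitness c) m (¬Holds⇒ {w} (closure-closed ψ₀ m) ¬h)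

      Holds⇒sat : Holds w (¬f φ) → sat M (¬f φ) (lift (w , c))
      Holds⇒sat h x = ⊥-elim (toWitness c (⇒-refute (Holds⇒ h) (Holds⇒ (to (IH w c) x))))

    truth-K : ∀ {i φ} → K i φ ∈ₗ cl → Truth φ → Truth (K i φ)
    truth-K {i} {φ} m IH w c = mk⇔
      (λ x → Thm⇒Holds (toWitness c) m (□-intro (K-normal i) i w φ (All.tabulate knowledge⇒K)
               (λ u cu s → Holds⇒ (to (IH u _) (x (state u cu) (lift (fromWitness s)))))))
      (λ h t r → from (IH _ _) (All.lookup (toWitness (lower r)) (source-knowledge m h K-source)))

    truth-E : ∀ {G g φ} → E G g φ ∈ₗ cl → Truth φ → Truth (E G g φ)
    truth-E {G} {g} {φ} m IH w c = mk⇔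
      (λ x → Thm⇒Holds (toWitness c) m (E-intro G g w φ
               (λ i Gi u cu s → Holds⇒ (to (IH u _) (x i Gi (state u cu) (lift (fromWitness s)))))))
      (λ h i Gi t r → from (IH _ _) (All.lookup (toWitness (lower r)) (source-knowledge m h (E-source Gi))))

    C-step : ∀ {G g φ w v i} → C G g φ ∈ₗ cl → Consistent w → Holds w (C G g φ) →
             G i → Succ i w v → Consistent v → Holds v φ × Holds v (C G g φ)
    C-step {G} {g} {φ} m cw h Gi s cv =
      let φ∈ , E∈ = closure-closed ψ₀ m
          hE      = Thm⇒Holds cw E∈ (⇒-trans (Holds⇒ h) (C1 G g φ))
          h∧      = All.lookup s (source-knowledge E∈ hE (E-source Gi))
      in Thm⇒Holds cv φ∈ (⇒-proj₁ (Holds⇒ h∧)) , Thm⇒Holds cv m (⇒-proj₂ {ψ = φ} (Holds⇒ h∧))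

    Holds-C⇒EGⁿ : ∀ {G g φ} → C G g φ ∈ₗ cl → Truth φ →
                  ∀ k w c → Holds w (C G g φ) → EGⁿ M G k (sat M φ) (lift (w , c))
    Holds-C⇒EGⁿ m IH zero    w c h i Gi t r =
      from (IH _ _) (proj₁ (C-step m (toWitness c) h Gi (toWitness (lower r)) (toWitness (proj₂ (lower t)))))
    Holds-C⇒EGⁿ m IH (suc k) w c h i Gi t r =
      Holds-C⇒EGⁿ m IH k _ _ (proj₂ (C-step m (toWitness c) h Gi (toWitness (lower r)) (toWitness (proj₂ (lower t)))))

    EGⁿ⇒Holds-C : ∀ {G g φ} → C G g φ ∈ₗ cl → Truth φ →
                  ∀ w c → (∀ k → EGⁿ M G k (sat M φ) (lift (w , c))) → Holds w (C G g φ)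
    EGⁿ⇒Holds-C {G} {g} {φ} m IH w c h =
      Thm⇒Holds (toWitness c) m (⇒-trans (⋁-∈ {L = ⌜ w ⌝ ∷ map ⌜_⌝ reachable} (here refl)) (RC1 G g invariant))
      where
      reachable : List Atom
      reachable = filter (λ v → lem {P = Reach G w v}) allAtoms

      X : Formula
      X = ⋁ (⌜ w ⌝ ∷ map ⌜_⌝ reachable)

      reached : ∀ v cv → Reach G w v → Thm (⌜ v ⌝ ⇒ φ ∧f X)
      reached v cv r = ⇒-∧ (Holds⇒ (to (IH v _) (reach-EGⁿ c r h cv)))
                           (⋁-∈ (there (∈-map⁺ ⌜_⌝ (∈-filter⁺ (λ v → lem) (∈-allVecs v) r))))

      invariant : Thm (X ⇒ E G g (φ ∧f X))
      invariant = ⋁-elim (⌜ w ⌝ ∷ map ⌜_⌝ reachable)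
        (E-intro G g w (φ ∧f X) (λ i Gi u cu s → reached u cu [ i , Gi , s , cu ]) ∷
         All.map⁺ {xs = reachable} (All.tabulate λ {v} v∈ → E-intro G g v (φ ∧f X) λ i Gi u cu s →
           reached u cu (proj₂ (∈-filter⁻ (λ v → lem {P = Reach G w v}) {xs = allAtoms} v∈) ∷ʳ (i , Gi , s , cu))))

    truth : ∀ {φ} → φ ∈ₗ cl → Truth φ
    truth {prim p}  m = truth-prim p
    truth {φ ∧f ψ}  m = truth-∧ m (truth (proj₁ (closure-closed ψ₀ m))) (truth (proj₂ (closure-closed ψ₀ m)))
    truth {¬f φ}    m = truth-¬ m (truth (closure-closed ψ₀ m))
    truth {K i φ}   m = truth-K m (truth (closure-closed ψ₀ m))
    truth {E G g φ} m = truth-E m (truth (closure-closed ψ₀ m))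
    truth {C G g φ} m w c = mk⇔ (EGⁿ⇒Holds-C m IH w c) (λ h k → Holds-C⇒EGⁿ m IH k w c h)
      where IH = truth (proj₁ (closure-closed ψ₀ m))

    complete : Valid ℓ ψ₀ → Thm ψ₀
    complete valid = by-atoms λ w c → Holds⇒ (to (truth (∈-closure ψ₀) w _) (valid M (state w c)))

corollary3p7 : (lem : ∀ {l} → ExcludedMiddle l) →
    (A Φ : Set) (𝒢 : Pred (Pred A 0ℓ) 0ℓ) →
    (∀ {G} → G ∈ 𝒢 → Satisfiable G) →
    (∀ {G H} → (∀ a → (G a → H a) × (H a → G a)) → G ∈ 𝒢 → H ∈ 𝒢) →
    (∀ {G H} → G ∈ 𝒢 → H ∈ 𝒢 → Satisfiable (G ∩ H) → (G ∩ H) ∈ 𝒢) →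
    (∀ {G} → G ∈ 𝒢 → Satisfiable (∁ G) → ∁ G ∈ 𝒢) →
    {ℓ : Level} → let open Logic A Φ 𝒢 in
    ∀ (φ : Formula) → Thm φ ⇔ Valid ℓ φ
corollary3p7 lem A Φ 𝒢 _ 𝒢-resp 𝒢-∩ _ φ =
  mk⇔ (λ ⊢φ M → Soundness.sound lem A Φ 𝒢 M ⊢φ) (Completeness.complete lem A Φ 𝒢 𝒢-resp 𝒢-∩ φ)
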